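{- Let $T$ be a tree with $n\ge1$ vertices, let $\nu$ be a self-reachable configuration on $T$, and let $t\in\{1,\dots,n\}$. Then $\nu$ is near-minimally self-reachable about $v_t$ if and only if both: (1) for each connected component $T'$ of $T\setminus v_t$, the restriction of $\nu$ to $T'$ is a minimally self-reachable configuration on $T'$; and (2) $\nu_t\ge \deg(v_t)+1$.
   Context: Label the vertices $v_1,\dots,v_n$; $e_i$ is the $i$th standard basis vector. A chip configuration on a tree is a vector of nonnegative integers indexed by its vertices. The Laplacian $\Delta(T)$ has $\Delta_{ii}=\deg(v_i)$, $\Delta_{ij}=-1$ if $v_iv_j$ is an edge, $0$ otherwise; firing $v_i$ from $c$ produces $c-\Delta(T)e_i$, legal if $c_i\ge\deg(v_i)$. A configuration is self-reachable on a tree if some nonempty finite sequence of legal firings starting from it returns to it. (Known: equivalently, it has at least $m-1$ chips on every $m$-vertex subtree.) A configuration on an $m$-vertex tree is minimally self-reachable if it is self-reachable with exactly $m-1$ chips. A configuration $\nu$ on $T$ is near-minimally self-reachable if it is self-reachable and not minimally self-reachable, and there is a unique $i$ with $\nu-e_i$ self-reachable on $T$; it is then called near-minimally self-reachable about $v_i$. $T\setminus v_t$ denotes the forest obtained by deleting $v_t$. -}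

module Defs where

open import Data.Nat using (ℕ; zero; suc; _+_; _*_; _∸_; _≤_)
open import Data.Fin using (Fin; _≟_)
import Data.Fin as F
open import Data.Bool using (Bool; true; false; if_then_else_; _∧_)
open import Data.Product using (Σ; ∃; _×_; _,_)
open import Relation.Binary.PropositionalEquality using (_≡_; _≢_)
open import Relation.Nullary.Decidable using (⌊_⌋)
open import Relation.Nullary using (¬_)

Σ[_] : ∀ {n} → (Fin n → ℕ) → ℕ
Σ[_] {zero} f = 0
Σ[_] {suc n} f = f F.zero + Σ[_] (λ i → f (F.suc i))

Subset : ℕ → Set
Subset n = Fin n → Bool

all : ∀ {n} → Subset n
all _ = true

Adj : ℕ → Set
Adj n = Fin n → Fin n → Bool

degIn : ∀ {n} → Adj n → Subset n → Fin n → ℕ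
degIn A S i = Σ[ (λ j → if S j ∧ A i j then 1 else 0) ]

deg : ∀ {n} → Adj n → Fin n → ℕ
deg A = degIn A all

data Walk {n} (A : Adj n) (S : Subset n) : Fin n → Fin n → Set where
  here : ∀ {i} → S i ≡ true → Walk A S i i
  step : ∀ {i j k} → S i ≡ true → A i j ≡ true → Walk A S j k → Walk A S i k

Connected : ∀ {n} → Adj n → Subset n → Set
Connected {n} A S = ∀ (i j : Fin n) → S i ≡ true → S j ≡ true → Walk A S i j

-- A tree: simple graph, connected, with exactly n-1 edges
-- (sum of degrees = 2(n-1)).
record Tree (n : ℕ) : Set where
  field
    adj     : Adj n
    irrefl  : ∀ i → adj i i ≡ false
    sym     : ∀ i j → adj i j ≡ adj j i
    conn    : Connected adj all
    edges   : Σ[ deg adj ] ≡ 2 * (n ∸ 1)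
open Tree public

Config : ℕ → Set
Config n = Fin n → ℕ

-- Firing vertex i in the subgraph induced by S: c - Δ_S e_i.
fire : ∀ {n} → Adj n → Subset n → Config n → Fin n → Config n
fire A S c i j =
  if ⌊ j ≟ i ⌋ then c j ∸ degIn A S i
  else (if S j ∧ A i j then suc (c j) else c j)

data Fires* {n} (A : Adj n) (S : Subset n) : Config n → Config n → Set where
  done : ∀ {c} → Fires* A S c c
  fireStep : ∀ {c c'} i → S i ≡ true → degIn A S i ≤ c i →
             Fires* A S (fire A S c i) c' → Fires* A S c c'

data Fires⁺ {n} (A : Adj n) (S : Subset n) : Config n → Config n → Set where
  fireStep : ∀ {c c'} i → S i ≡ true → degIn A S i ≤ c i →
             Fires* A S (fire A S c i) c' → Fires⁺ A S c c'

SelfReachable : ∀ {n} → Adj n → Subset n → Config n → Set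
SelfReachable {n} A S c =
  ∃ λ (c' : Config n) → Fires⁺ A S c c' × (∀ j → S j ≡ true → c' j ≡ c j)

chips : ∀ {n} → Subset n → Config n → ℕ
chips S c = Σ[ (λ j → if S j then c j else 0) ]

size : ∀ {n} → Subset n → ℕ
size S = Σ[ (λ j → if S j then 1 else 0) ]

MinSelfReachable : ∀ {n} → Adj n → Subset n → Config n → Set
MinSelfReachable A S c = SelfReachable A S c × chips S c ≡ size S ∸ 1

-- ν - e_i (only used when ν i ≥ 1)
minusE : ∀ {n} → Config n → Fin n → Config n
minusE c i j = if ⌊ j ≟ i ⌋ then c j ∸ 1 else c j

-- ν - e_i is a (nonnegative) configuration that is self-reachable on T.
MinusSR : ∀ {n} → Tree n → Config n → Fin n → Set
MinusSR T ν i = 1 ≤ ν i × SelfReachable (adj T) all (minusE ν i)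

NearMinSRAbout : ∀ {n} → Tree n → Config n → Fin n → Set
NearMinSRAbout {n} T ν t =
  SelfReachable (adj T) all ν × ¬ MinSelfReachable (adj T) all ν ×
  MinusSR T ν t × (∀ (i : Fin n) → MinusSR T ν i → i ≡ t)

Component : ∀ {n} → Tree n → Fin n → Subset n → Set
Component {n} T t C =
  C t ≡ false ×
  (∃ λ (i : Fin n) → C i ≡ true) ×
  Connected (adj T) C ×
  (∀ (i j : Fin n) → C i ≡ true → adj T i j ≡ true → j ≢ t → C j ≡ true)

-- A configuration c on a connected vertex set S is self-reachable iff it admits a firing order:
-- an injective ranking of S in which every vertex holds at least as many chips as it has
-- higher-ranked neighbours (fire everything once in rank order; conversely, rank the vertices by
-- the time of their last firing). Summing these neighbour counts over S counts every edge inside S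
-- once, so such a c has at least |S| - 1 chips on S, and on a subtree it has exactly |S| - 1 iff
-- every vertex is tight, i.e. holds exactly its number of higher-ranked neighbours.
--
-- If ν is near-minimal about t, fix a firing order of ν - e_t. Every v ≠ t is tight, since
-- otherwise the same order serves ν - e_v. Every neighbour of t ranks above t, since otherwise
-- moving t just below its highest lower neighbour m gives a firing order of ν - e_m. Hence
-- ν t > deg t, and on each component C of T ∖ t, a subtree, the restricted order is tight, so ν
-- has exactly |C| - 1 chips there. Conversely, moving t to the bottom of a firing order of ν gives
-- one of ν - e_t, which therefore carries at least n - 1 chips, so ν is not minimal; and for i ≠ t
-- a firing order of ν - e_i would need |C| - 1 chips on the component C of i, which holds |C| - 2.
module Submission where

open import Defs
open import Data.Nat using (ℕ; zero; suc; _+_; _*_; _∸_; _≤_; _<_; z≤n; s≤s; _<ᵇ_; _≤?_; _<?_)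
  renaming (_≟_ to _≟ℕ_)
open import Data.Nat.Properties hiding (_≟_)
open import Data.Nat.GeneralisedArithmetic using (fold)
open import Data.Nat.Tactic.RingSolver using (solve-∀)
open import Data.Fin using (Fin; zero; suc; _≟_)
import Data.Fin.Properties as FinP
open import Data.Bool using (Bool; true; false; if_then_else_; _∧_; _∨_; not)
import Data.Bool as B
open import Data.Bool.Properties using (∨-inverseʳ; ∨-zeroʳ; ∧-zeroʳ; ∧-identityʳ)
open import Data.Product using (∃; _×_; _,_; proj₂)
open import Data.Sum using (_⊎_; inj₁; inj₂)
open import Data.Empty using (⊥-elim)
open import Data.Vec.Functional using (updateAt)
open import Data.Vec.Functional.Properties using (updateAt-updates; updateAt-minimal)
open import Algebra.Properties.CommutativeMonoid.Sum +-0-commutativeMonoid using (sum; ∑-distrib-+; ∑-comm)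
open import Function.Base using (_∘_)
open import Function.Bundles using (_⇔_; mk⇔)
open import Relation.Binary.PropositionalEquality
  using (_≡_; _≢_; _≗_; refl; cong; cong₂; subst; subst₂; trans; ≡-≟-identity; ≢-≟-identity;
         module ≡-Reasoning)
  renaming (sym to ≡-sym)
open import Relation.Nullary using (¬_; yes; no; Dec)
open import Relation.Nullary.Decidable using (⌊_⌋; _×-dec_; does; dec-true; does-⇔; toSum)
open import Relation.Nullary.Reflects using (ofʸ; ofⁿ)
open import Relation.Unary using (Decidable)

𝟙 : Bool → ℕ
𝟙 b = if b then 1 else 0

𝟙-∧ˡ : ∀ a b → 𝟙 (a ∧ b) ≤ 𝟙 a
𝟙-∧ˡ true  true  = ≤-refl
𝟙-∧ˡ true  false = z≤n
𝟙-∧ˡ false b     = z≤n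

𝟙-∧-mono : ∀ a {b c} → (b ≡ true → c ≡ true) → 𝟙 (a ∧ b) ≤ 𝟙 (a ∧ c)
𝟙-∧-mono false _ = z≤n
𝟙-∧-mono true {false} _ = z≤n
𝟙-∧-mono true {true} b⇒c rewrite b⇒c refl = ≤-refl

∧-true : ∀ {a b} → a ∧ b ≡ true → a ≡ true × b ≡ true
∧-true {true} {true} _ = refl , refl

not≡true : ∀ {b} → not b ≡ true → b ≡ false
not≡true {false} _ = refl

does-true⇒ : ∀ {p} {P : Set p} (P? : Dec P) → does P? ≡ true → P
does-true⇒ (yes p) _ = p

≟-refl : ∀ {n} (i : Fin n) → ⌊ i ≟ i ⌋ ≡ true
≟-refl i = cong ⌊_⌋ (≡-≟-identity _≟_ refl)

≟-≢ : ∀ {n} {i j : Fin n} → i ≢ j → ⌊ i ≟ j ⌋ ≡ false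
≟-≢ i≢j = cong ⌊_⌋ (≢-≟-identity _≟_ i≢j)

<ᵇ-true : ∀ {m n} → m < n → (m <ᵇ n) ≡ true
<ᵇ-true {m} {n} m<n with m <ᵇ n | <ᵇ-reflects-< m n
... | true  | _       = refl
... | false | ofⁿ m≮n = ⊥-elim (m≮n m<n)

<ᵇ-true⁻¹ : ∀ {m n} → (m <ᵇ n) ≡ true → m < n
<ᵇ-true⁻¹ {m} {n} _ with m <ᵇ n | <ᵇ-reflects-< m n
... | true | ofʸ m<n = m<n

<ᵇ-false : ∀ {m n} → ¬ m < n → (m <ᵇ n) ≡ false
<ᵇ-false {m} {n} m≮n with m <ᵇ n | <ᵇ-reflects-< m n
... | true  | ofʸ m<n = ⊥-elim (m≮n m<n)
... | false | _       = refl

<ᵇ-cong : ∀ {a b c d} → (a < b → c < d) → (c < d → a < b) → (a <ᵇ b) ≡ (c <ᵇ d)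
<ᵇ-cong {a} {b} to from with a <ᵇ b | <ᵇ-reflects-< a b
... | true  | ofʸ a<b = ≡-sym (<ᵇ-true (to a<b))
... | false | ofⁿ a≮b = ≡-sym (<ᵇ-false (a≮b ∘ from))

<⇒≤∸1 : ∀ {x m} → x < m → x ≤ m ∸ 1
<⇒≤∸1 (s≤s x≤m-1) = x≤m-1

≤∸1⇒< : ∀ {x m} → 1 ≤ m → x ≤ m ∸ 1 → x < m
≤∸1⇒< {m = suc _} _ x≤m-1 = s≤s x≤m-1

maximum : ∀ {n p} {P : Fin n → Set p} → Decidable P → (f : Fin n → ℕ) → ∃ P →
  ∃ λ m → P m × (∀ w → P w → f w ≤ f m)
maximum {suc n} P? f (u , Pu) with FinP.any? (P? ∘ suc)
... | no ¬P-tail with u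
...   | zero  = zero , Pu , λ { zero _ → ≤-refl ; (suc w) Pw → ⊥-elim (¬P-tail (w , Pw)) }
...   | suc w = ⊥-elim (¬P-tail (w , Pu))
maximum {suc n} P? f (u , Pu) | yes P-tail with maximum (P? ∘ suc) (f ∘ suc) P-tail | P? zero
... | m , Pm , m-max | no ¬P0 = suc m , Pm , λ { zero P0 → ⊥-elim (¬P0 P0) ; (suc w) Pw → m-max w Pw }
... | m , Pm , m-max | yes P0 with f zero ≤? f (suc m)
...   | yes f0≤fm = suc m , Pm , λ { zero _ → f0≤fm ; (suc w) Pw → m-max w Pw }
...   | no  f0≰fm = zero , P0 , λ { zero _ → ≤-refl ; (suc w) Pw → ≤-trans (m-max w Pw) (≰⇒≥ f0≰fm) }

-- Finite sums and subsets

Σ≡sum : ∀ {n} (f : Fin n → ℕ) → Σ[ f ] ≡ sum f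
Σ≡sum {zero} f = refl
Σ≡sum {suc n} f = cong (f zero +_) (Σ≡sum (f ∘ suc))

Σ-cong : ∀ {n} {f g : Fin n → ℕ} → f ≗ g → Σ[ f ] ≡ Σ[ g ]
Σ-cong {zero} f≗g = refl
Σ-cong {suc n} f≗g = cong₂ _+_ (f≗g zero) (Σ-cong (f≗g ∘ suc))

Σ-mono-≤ : ∀ {n} {f g : Fin n → ℕ} → (∀ i → f i ≤ g i) → Σ[ f ] ≤ Σ[ g ]
Σ-mono-≤ {zero} f≤g = z≤n
Σ-mono-≤ {suc n} f≤g = +-mono-≤ (f≤g zero) (Σ-mono-≤ (f≤g ∘ suc))

Σ-distrib-+ : ∀ {n} (f g : Fin n → ℕ) → Σ[ (λ i → f i + g i) ] ≡ Σ[ f ] + Σ[ g ]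
Σ-distrib-+ f g = begin
  Σ[ (λ i → f i + g i) ]  ≡⟨ Σ≡sum (λ i → f i + g i) ⟩
  sum (λ i → f i + g i)   ≡⟨ ∑-distrib-+ f g ⟩
  sum f + sum g           ≡⟨ cong₂ _+_ (Σ≡sum f) (Σ≡sum g) ⟨
  Σ[ f ] + Σ[ g ]         ∎
  where open ≡-Reasoning

Σ-comm : ∀ {n} (f : Fin n → Fin n → ℕ) → Σ[ (λ i → Σ[ f i ]) ] ≡ Σ[ (λ j → Σ[ (λ i → f i j) ]) ]
Σ-comm f = begin
  Σ[ (λ i → Σ[ f i ]) ]            ≡⟨ trans (Σ-cong (λ i → Σ≡sum (f i))) (Σ≡sum (λ i → sum (f i))) ⟩
  sum (λ i → sum (f i))            ≡⟨ ∑-comm f ⟩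
  sum (λ j → sum (λ i → f i j))    ≡⟨ trans (Σ-cong (λ j → Σ≡sum (λ i → f i j)))
                                            (Σ≡sum (λ j → sum (λ i → f i j))) ⟨
  Σ[ (λ j → Σ[ (λ i → f i j) ]) ]  ∎
  where open ≡-Reasoning

≤-Σ : ∀ {n} (f : Fin n → ℕ) i → f i ≤ Σ[ f ]
≤-Σ f zero = m≤m+n _ _
≤-Σ f (suc i) = ≤-trans (≤-Σ (f ∘ suc) i) (m≤n+m _ _)

Σ-update : ∀ {n} {f g : Fin n → ℕ} v → (∀ w → w ≢ v → f w ≡ g w) → Σ[ f ] + g v ≡ Σ[ g ] + f v
Σ-update {f = f} {g} zero agree =
  trans (cong (λ s → f zero + s + g zero) (Σ-cong (λ w → agree (suc w) λ ())))
        (swap-ends (f zero) _ (g zero))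
  where swap-ends : ∀ a s b → a + s + b ≡ b + s + a
        swap-ends = solve-∀
Σ-update {f = f} {g} (suc v) agree =
  trans (+-assoc (f zero) _ _)
        (trans (cong₂ _+_ (agree zero λ ()) (Σ-update v (λ w w≢v → agree (suc w) (w≢v ∘ FinP.suc-injective))))
               (≡-sym (+-assoc (g zero) _ _)))

Σ-zero : ∀ {n} → Σ[ (λ (_ : Fin n) → 0) ] ≡ 0
Σ-zero {zero} = refl
Σ-zero {suc n} = Σ-zero {n}

Σ-one : ∀ {n} → Σ[ (λ (_ : Fin n) → 1) ] ≡ n
Σ-one {zero} = refl
Σ-one {suc n} = cong suc (Σ-one {n})

module _ {n : ℕ} where

  infixr 6 _∪_
  infix 4 _⊆_

  _⊆_ : Subset n → Subset n → Set
  S ⊆ S′ = ∀ j → S j ≡ true → S′ j ≡ true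

  Disjoint : Subset n → Subset n → Set
  Disjoint S S′ = ∀ j → S j ≡ true → S′ j ≡ false

  _∪_ : Subset n → Subset n → Subset n
  (S ∪ S′) j = S j ∨ S′ j

  ∁ : Subset n → Subset n
  ∁ S j = not (S j)

  ⁅_⁆ : Fin n → Subset n
  ⁅ v ⁆ j = ⌊ j ≟ v ⌋

  sumOver : Subset n → (Fin n → ℕ) → ℕ
  sumOver S f = Σ[ (λ j → if S j then f j else 0) ]

  sumOver-cong : ∀ S {f g : Fin n → ℕ} → (∀ j → S j ≡ true → f j ≡ g j) →
    sumOver S f ≡ sumOver S g
  sumOver-cong S f≡g = Σ-cong pointwise
    where pointwise : ∀ j → (if S j then _ else 0) ≡ (if S j then _ else 0)
          pointwise j with S j in Sj
          ... | true  = f≡g j Sj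
          ... | false = refl

  sumOver-mono-≤ : ∀ S {f g : Fin n → ℕ} → (∀ j → S j ≡ true → f j ≤ g j) →
    sumOver S f ≤ sumOver S g
  sumOver-mono-≤ S f≤g = Σ-mono-≤ pointwise
    where pointwise : ∀ j → (if S j then _ else 0) ≤ (if S j then _ else 0)
          pointwise j with S j in Sj
          ... | true  = f≤g j Sj
          ... | false = z≤n

  sumOver-⊆ : ∀ {S S′} f → S ⊆ S′ → sumOver S f ≤ sumOver S′ f
  sumOver-⊆ {S} {S′} f S⊆S′ = Σ-mono-≤ pointwise
    where pointwise : ∀ j → (if S j then f j else 0) ≤ (if S′ j then f j else 0)
          pointwise j with S j in Sj
          ... | true  rewrite S⊆S′ j Sj = ≤-refl
          ... | false = z≤n

  sumOver-⊆-≡ : ∀ {S S′} f → S ⊆ S′ → (∀ j → S′ j ≡ true → S j ≡ false → f j ≡ 0) →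
    sumOver S f ≡ sumOver S′ f
  sumOver-⊆-≡ {S} {S′} f S⊆S′ outside-S = Σ-cong pointwise
    where pointwise : ∀ j → (if S j then f j else 0) ≡ (if S′ j then f j else 0)
          pointwise j with S j in Sj | S′ j in S′j
          ... | true  | true  = refl
          ... | true  | false with () ← trans (≡-sym (S⊆S′ j Sj)) S′j
          ... | false | true  = ≡-sym (outside-S j S′j Sj)
          ... | false | false = refl

  sumOver-≗ : ∀ {S S′} f → S ≗ S′ → sumOver S f ≡ sumOver S′ f
  sumOver-≗ f S≗S′ = Σ-cong (λ j → cong (λ b → if b then f j else 0) (S≗S′ j))

  sumOver-+ : ∀ S (f g : Fin n → ℕ) → sumOver S (λ j → f j + g j) ≡ sumOver S f + sumOver S g
  sumOver-+ S f g =
    trans (Σ-cong pointwise) (Σ-distrib-+ (λ j → if S j then f j else 0) (λ j → if S j then g j else 0))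
    where pointwise : ∀ j → (if S j then f j + g j else 0) ≡ (if S j then f j else 0) + (if S j then g j else 0)
          pointwise j with S j
          ... | true  = refl
          ... | false = refl

  sumOver-∪ : ∀ {S S′} f → Disjoint S S′ → sumOver (S ∪ S′) f ≡ sumOver S f + sumOver S′ f
  sumOver-∪ {S} {S′} f disjoint =
    trans (Σ-cong pointwise) (Σ-distrib-+ (λ j → if S j then f j else 0) (λ j → if S′ j then f j else 0))
    where pointwise : ∀ j → (if S j ∨ S′ j then f j else 0) ≡
                            (if S j then f j else 0) + (if S′ j then f j else 0)
          pointwise j with S j in Sj
          ... | true  rewrite disjoint j Sj = ≡-sym (+-identityʳ _)
          ... | false = refl

  sumOver-zero : ∀ S → sumOver S (λ _ → 0) ≡ 0
  sumOver-zero S = trans (Σ-cong (λ j → if-zero (S j))) (Σ-zero {n})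
    where if-zero : ∀ b → (if b then 0 else 0) ≡ 0
          if-zero true  = refl
          if-zero false = refl

  sumOver-update : ∀ S {f g : Fin n → ℕ} {v} → S v ≡ true →
    (∀ w → S w ≡ true → w ≢ v → f w ≡ g w) → sumOver S f + g v ≡ sumOver S g + f v
  sumOver-update S {f} {g} {v} Sv agree =
    subst₂ (λ a b → sumOver S f + a ≡ sumOver S g + b)
           (cong (λ b → if b then g v else 0) Sv) (cong (λ b → if b then f v else 0) Sv)
           (Σ-update v masked)
    where masked : ∀ w → w ≢ v → (if S w then f w else 0) ≡ (if S w then g w else 0)
          masked w w≢v with S w in Sw
          ... | true  = agree w Sw w≢v
          ... | false = refl

  sumOver-⁅⁆ : ∀ v f → sumOver ⁅ v ⁆ f ≡ f v
  sumOver-⁅⁆ v f = begin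
    sumOver ⁅ v ⁆ f                   ≡⟨ +-identityʳ _ ⟨
    sumOver ⁅ v ⁆ f + 0               ≡⟨ Σ-update {n} v outside ⟩
    Σ[ (λ (_ : Fin n) → 0) ] + at v   ≡⟨ cong (_+ at v) (Σ-zero {n}) ⟩
    at v                              ≡⟨ cong (λ b → if b then f v else 0) (≟-refl v) ⟩
    f v                               ∎
    where open ≡-Reasoning
          at : Fin n → ℕ
          at j = if ⌊ j ≟ v ⌋ then f j else 0
          outside : ∀ w → w ≢ v → at w ≡ 0
          outside w w≢v rewrite ≟-≢ w≢v = refl

  ≤-sumOver : ∀ S f {j} → S j ≡ true → f j ≤ sumOver S f
  ≤-sumOver S f {j} Sj = ≤-trans (subst (λ b → f j ≤ (if b then f j else 0)) (≡-sym Sj) ≤-refl)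
                                 (≤-Σ (λ j → if S j then f j else 0) j)

  sumOver-comm : ∀ S S′ (f : Fin n → Fin n → ℕ) →
    sumOver S (λ a → sumOver S′ (f a)) ≡ sumOver S′ (λ b → sumOver S (λ a → f a b))
  sumOver-comm S S′ f = begin
    sumOver S (λ a → sumOver S′ (f a))
      ≡⟨ Σ-cong (λ a → if-Σ (S a) _) ⟩
    Σ[ (λ a → Σ[ (λ b → if S a then (if S′ b then f a b else 0) else 0) ]) ]
      ≡⟨ Σ-comm (λ a b → if S a then (if S′ b then f a b else 0) else 0) ⟩
    Σ[ (λ b → Σ[ (λ a → if S a then (if S′ b then f a b else 0) else 0) ]) ]
      ≡⟨ Σ-cong (λ b → Σ-cong (λ a → if-swap (S a) (S′ b))) ⟩
    Σ[ (λ b → Σ[ (λ a → if S′ b then (if S a then f a b else 0) else 0) ]) ]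
      ≡⟨ Σ-cong (λ b → if-Σ (S′ b) _) ⟨
    sumOver S′ (λ b → sumOver S (λ a → f a b))
      ∎
    where
      open ≡-Reasoning
      if-Σ : ∀ b (g : Fin n → ℕ) → (if b then Σ[ g ] else 0) ≡ Σ[ (λ w → if b then g w else 0) ]
      if-Σ true g = refl
      if-Σ false g = ≡-sym (Σ-zero {n})
      if-swap : ∀ x y {v : ℕ} → (if x then (if y then v else 0) else 0) ≡ (if y then (if x then v else 0) else 0)
      if-swap true y = refl
      if-swap false true = refl
      if-swap false false = refl

  ⁅⁆-≡ : ∀ {j v} → ⁅ v ⁆ j ≡ true → j ≡ v
  ⁅⁆-≡ {j} {v} j≡v with j ≟ v
  ... | yes eq = eq
  ... | no _ with () ← j≡v

  ⁅⁆-⊆ : ∀ {S v} → S v ≡ true → ⁅ v ⁆ ⊆ S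
  ⁅⁆-⊆ {S} Sv j j≡v = subst (λ y → S y ≡ true) (≡-sym (⁅⁆-≡ j≡v)) Sv

  ⁅⁆-disjoint : ∀ S {v} → S v ≡ false → Disjoint S ⁅ v ⁆
  ⁅⁆-disjoint S {v} Sv j Sj = ≟-≢ j≢v
    where j≢v : j ≢ v
          j≢v refl with () ← trans (≡-sym Sj) Sv

  ⊆-∪ˡ : ∀ {S S′} → S ⊆ S ∪ S′
  ⊆-∪ˡ j Sj rewrite Sj = refl

  ∪-⊆ : ∀ {S S′ S″} → S ⊆ S″ → S′ ⊆ S″ → S ∪ S′ ⊆ S″
  ∪-⊆ {S} S⊆S″ S′⊆S″ j S∪S′j with S j in Sj
  ... | true  = S⊆S″ j Sj
  ... | false = S′⊆S″ j S∪S′j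

  ∁-disjoint : ∀ S → Disjoint S (∁ S)
  ∁-disjoint S j Sj = cong not Sj

  ∪-∁ : ∀ S → S ∪ ∁ S ≗ all
  ∪-∁ S j = ∨-inverseʳ (S j)

  size-all : size (all {n}) ≡ n
  size-all = Σ-one {n}

  size≤n : ∀ S → size S ≤ n
  size≤n S = subst (size S ≤_) size-all (sumOver-⊆ {S} (λ _ → 1) (λ _ _ → refl))

  size≥1 : ∀ S {j} → S j ≡ true → 1 ≤ size S
  size≥1 S Sj = ≤-sumOver S (λ _ → 1) Sj

  size-⁅⁆ : ∀ v → size ⁅ v ⁆ ≡ 1
  size-⁅⁆ v = sumOver-⁅⁆ v (λ _ → 1)

  size-∪-⁅⁆ : ∀ S {v} → S v ≡ false → size (S ∪ ⁅ v ⁆) ≡ suc (size S)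
  size-∪-⁅⁆ S {v} Sv = trans (sumOver-∪ (λ _ → 1) (⁅⁆-disjoint S Sv))
                             (trans (cong (size S +_) (size-⁅⁆ v)) (+-comm (size S) 1))

  size-∁ : ∀ S → size S + size (∁ S) ≡ n
  size-∁ S = trans (≡-sym (sumOver-∪ (λ _ → 1) (∁-disjoint S)))
                   (trans (sumOver-≗ (λ _ → 1) (∪-∁ S)) size-all)

  ⊂⇒size< : ∀ {S S′ j} → S ⊆ S′ → S′ j ≡ true → S j ≡ false → size S < size S′
  ⊂⇒size< {S} {S′} {j} S⊆S′ S′j Sj = begin-strict
    size S             <⟨ n<1+n (size S) ⟩
    suc (size S)       ≡⟨ size-∪-⁅⁆ S Sj ⟨
    size (S ∪ ⁅ j ⁆)   ≤⟨ sumOver-⊆ (λ _ → 1) (∪-⊆ S⊆S′ (⁅⁆-⊆ S′j)) ⟩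
    size S′            ∎
    where open ≤-Reasoning

  size<⇒∃∉ : ∀ {F S} → size F < size S → ∃ λ y → S y ≡ true × F y ≡ false
  size<⇒∃∉ {F} {S} |F|<|S| with FinP.any? (λ y → (S y B.≟ true) ×-dec (F y B.≟ false))
  ... | yes found = found
  ... | no ¬found = ⊥-elim (<⇒≱ |F|<|S| (sumOver-⊆ (λ _ → 1) S⊆F))
    where S⊆F : S ⊆ F
          S⊆F y Sy with F y in Fy
          ... | true  = refl
          ... | false = ⊥-elim (¬found (y , Sy , Fy))

module _ {n} (f : Subset n → Subset n) (inflationary : ∀ S → S ⊆ f S)
         (extensional : ∀ {S S′} → S ≗ S′ → f S ≗ f S′) where

  grows-or-stable : ∀ S → f S ≗ S ⊎ size S < size (f S)
  grows-or-stable S with FinP.all? (λ j → f S j B.≟ S j)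
  ... | yes stable = inj₁ stable
  ... | no ¬stable with FinP.¬∀⟶∃¬ n _ (λ j → f S j B.≟ S j) ¬stable
  ... | j , fSj≢Sj with S j in Sj
  ...   | true = ⊥-elim (fSj≢Sj (inflationary S j Sj))
  ...   | false with f S j in fSj
  ...     | false = ⊥-elim (fSj≢Sj refl)
  ...     | true  = inj₂ (⊂⇒size< (inflationary S) fSj Sj)

  -- A strictly growing chain of subsets of Fin n has length at most n.
  fold-stable : ∀ S → f (fold S f n) ≗ fold S f n
  fold-stable S with stable-or-large n
    where
      stable-or-large : ∀ k → f (fold S f k) ≗ fold S f k ⊎ k ≤ size (fold S f k)
      stable-or-large zero = inj₂ z≤n
      stable-or-large (suc k) with stable-or-large k
      ... | inj₁ stable = inj₁ (extensional stable)
      ... | inj₂ k≤size with grows-or-stable (fold S f k)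
      ...   | inj₁ stable = inj₁ (extensional stable)
      ...   | inj₂ grows  = inj₂ (≤-trans (s≤s k≤size) grows)
  ... | inj₁ stable = stable
  ... | inj₂ n≤size with grows-or-stable (fold S f n)
  ...   | inj₁ stable = stable
  ...   | inj₂ grows  = ⊥-elim (<⇒≱ (≤-trans (s≤s n≤size) grows) (size≤n (f (fold S f n))))

-- Walks and edge counts

module _ {n} {A : Adj n} {S : Subset n} where

  walk-++ : ∀ {i j k} → Walk A S i j → Walk A S j k → Walk A S i k
  walk-++ (here _) q = q
  walk-++ (step Si Aij p) q = step Si Aij (walk-++ p q)

  walk-start : ∀ {i j} → Walk A S i j → S i ≡ true
  walk-start (here Si) = Si
  walk-start (step Si _ _) = Si

  walk-reverse : (∀ i j → A i j ≡ A j i) → ∀ {i j} → Walk A S i j → Walk A S j i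
  walk-reverse symmetric (here Si) = here Si
  walk-reverse symmetric (step {i} {j} Si Aij p) =
    walk-++ (walk-reverse symmetric p) (step (walk-start p) (trans (symmetric j i) Aij) (here Si))

  walk-⊆ : ∀ {S′} → S ⊆ S′ → ∀ {i j} → Walk A S i j → Walk A S′ i j
  walk-⊆ S⊆S′ (here Si) = here (S⊆S′ _ Si)
  walk-⊆ S⊆S′ (step Si Aij p) = step (S⊆S′ _ Si) Aij (walk-⊆ S⊆S′ p)

  walk-leaves : ∀ (F : Subset n) {i j} → Walk A S i j → F i ≡ true → F j ≡ false →
    ∃ λ u → ∃ λ v → F u ≡ true × F v ≡ false × S v ≡ true × A u v ≡ true
  walk-leaves F (here _) Fi Fj with () ← trans (≡-sym Fi) Fj
  walk-leaves F (step {i} {k} _ Aik p) Fi Fj with F k in Fk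
  ... | true  = walk-leaves F p Fk Fj
  ... | false = i , k , Fi , Fk , walk-start p , Aik

module _ {n} (A : Adj n) where

  adjPairs : Subset n → Subset n → ℕ
  adjPairs S S′ = sumOver S (λ a → sumOver S′ (λ b → 𝟙 (A a b)))

  -- Twice the number of edges inside S; degSum A all is definitionally Σ[ deg A ].
  degSum : Subset n → ℕ
  degSum S = adjPairs S S

  degIn≡sumOver : ∀ S v → degIn A S v ≡ sumOver S (λ w → 𝟙 (A v w))
  degIn≡sumOver S v = Σ-cong pointwise
    where pointwise : ∀ w → 𝟙 (S w ∧ A v w) ≡ (if S w then 𝟙 (A v w) else 0)
          pointwise w with S w
          ... | true  = refl
          ... | false = refl

  adjPairs-∪ʳ : ∀ H {F G} → Disjoint F G → adjPairs H (F ∪ G) ≡ adjPairs H F + adjPairs H G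
  adjPairs-∪ʳ H {F} {G} disjoint = begin
    adjPairs H (F ∪ G)
      ≡⟨ sumOver-cong H (λ a _ → sumOver-∪ (λ b → 𝟙 (A a b)) disjoint) ⟩
    sumOver H (λ a → sumOver F (λ b → 𝟙 (A a b)) + sumOver G (λ b → 𝟙 (A a b)))
      ≡⟨ sumOver-+ H _ _ ⟩
    adjPairs H F + adjPairs H G
      ∎
    where open ≡-Reasoning

  adjPairs-⁅⁆ : ∀ F v → adjPairs F ⁅ v ⁆ ≡ sumOver F (λ a → 𝟙 (A a v))
  adjPairs-⁅⁆ F v = sumOver-cong F (λ a _ → sumOver-⁅⁆ v (λ b → 𝟙 (A a b)))

  degSum-⊆ : ∀ {F S} → F ⊆ S → degSum F ≤ degSum S
  degSum-⊆ {F} {S} F⊆S =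
    ≤-trans (sumOver-mono-≤ F (λ a _ → sumOver-⊆ (λ b → 𝟙 (A a b)) F⊆S))
            (sumOver-⊆ (λ a → sumOver S (λ b → 𝟙 (A a b))) F⊆S)

  degSum-≗ : ∀ {F S} → F ≗ S → degSum F ≡ degSum S
  degSum-≗ {F} {S} F≗S =
    trans (sumOver-cong F (λ a _ → sumOver-≗ (λ b → 𝟙 (A a b)) F≗S))
          (sumOver-≗ (λ a → sumOver S (λ b → 𝟙 (A a b))) F≗S)

  crossing-edge : ∀ {C x y} → Connected A all → C x ≡ true → C y ≡ false → 1 ≤ adjPairs C (∁ C)
  crossing-edge {C} {x} {y} connected Cx Cy with walk-leaves C (connected x y refl refl) Cx Cy
  ... | u , v , Cu , Cv , _ , Auv = begin
    1                                 ≡⟨ cong 𝟙 Auv ⟨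
    𝟙 (A u v)                         ≤⟨ ≤-sumOver (∁ C) (λ b → 𝟙 (A u b)) (cong not Cv) ⟩
    sumOver (∁ C) (λ b → 𝟙 (A u b))   ≤⟨ ≤-sumOver C (λ a → sumOver (∁ C) (λ b → 𝟙 (A a b))) Cu ⟩
    adjPairs C (∁ C)                  ∎
    where open ≤-Reasoning

  module _ (symmetric : ∀ i j → A i j ≡ A j i) where

    adjPairs-comm : ∀ F G → adjPairs F G ≡ adjPairs G F
    adjPairs-comm F G = trans (sumOver-comm F G (λ a b → 𝟙 (A a b)))
      (sumOver-cong G (λ b _ → sumOver-cong F (λ a _ → cong 𝟙 (symmetric a b))))

    degSum-∪ : ∀ {F G} → Disjoint F G → degSum (F ∪ G) ≡ degSum F + degSum G + 2 * adjPairs F G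
    degSum-∪ {F} {G} disjoint = begin
      degSum (F ∪ G)
        ≡⟨ sumOver-∪ (λ a → sumOver (F ∪ G) (λ b → 𝟙 (A a b))) disjoint ⟩
      adjPairs F (F ∪ G) + adjPairs G (F ∪ G)
        ≡⟨ cong₂ _+_ (adjPairs-∪ʳ F disjoint) (adjPairs-∪ʳ G disjoint) ⟩
      (degSum F + adjPairs F G) + (adjPairs G F + degSum G)
        ≡⟨ cong (λ x → (degSum F + adjPairs F G) + (x + degSum G)) (adjPairs-comm G F) ⟩
      (degSum F + adjPairs F G) + (adjPairs F G + degSum G)
        ≡⟨ rearrange (degSum F) (adjPairs F G) (degSum G) ⟩
      degSum F + degSum G + 2 * adjPairs F G
        ∎
      where
        open ≡-Reasoning
        rearrange : ∀ a b c → (a + b) + (b + c) ≡ a + c + 2 * b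
        rearrange = solve-∀

    degSum-∁ : ∀ C → degSum C + degSum (∁ C) + 2 * adjPairs C (∁ C) ≡ degSum all
    degSum-∁ C = trans (≡-sym (degSum-∪ (∁-disjoint C))) (degSum-≗ (∪-∁ C))

    degSum-add-neighbour : ∀ {F u v} → F u ≡ true → F v ≡ false → A u v ≡ true →
      2 + degSum F ≤ degSum (F ∪ ⁅ v ⁆)
    degSum-add-neighbour {F} {u} {v} Fu Fv Auv = begin
      2 + degSum F                                      ≡⟨ +-comm 2 _ ⟩
      degSum F + 2 * 1                                  ≤⟨ +-mono-≤ (m≤m+n _ _) (*-monoʳ-≤ 2 edge) ⟩
      degSum F + degSum ⁅ v ⁆ + 2 * adjPairs F ⁅ v ⁆   ≡⟨ degSum-∪ (⁅⁆-disjoint F Fv) ⟨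
      degSum (F ∪ ⁅ v ⁆)                                ∎
      where
        open ≤-Reasoning
        edge : 1 ≤ adjPairs F ⁅ v ⁆
        edge = subst₂ _≤_ (cong 𝟙 Auv) (≡-sym (adjPairs-⁅⁆ F v)) (≤-sumOver F (λ a → 𝟙 (A a v)) Fu)

    connected⇒subset-of-size : ∀ {S x} → Connected A S → S x ≡ true → ∀ k → suc k ≤ size S →
      ∃ λ F → F ⊆ S × F x ≡ true × size F ≡ suc k × 2 * k ≤ degSum F
    connected⇒subset-of-size {S} {x} conn Sx zero _ =
      ⁅ x ⁆ , ⁅⁆-⊆ Sx , ≟-refl x , size-⁅⁆ x , z≤n
    connected⇒subset-of-size {S} {x} conn Sx (suc k) k+2≤|S|
      with connected⇒subset-of-size conn Sx k (≤-trans (n≤1+n _) k+2≤|S|)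
    ... | F , F⊆S , Fx , |F| , degF
      with size<⇒∃∉ {F = F} {S = S} (subst (_< size S) (≡-sym |F|) k+2≤|S|)
    ... | y , Sy , Fy with walk-leaves F (conn x y Sx Sy) Fx Fy
    ... | u , v , Fu , Fv , Sv , Auv =
      F ∪ ⁅ v ⁆ , ∪-⊆ F⊆S (⁅⁆-⊆ Sv) , ⊆-∪ˡ {S = F} {⁅ v ⁆} x Fx ,
      trans (size-∪-⁅⁆ F Fv) (cong suc |F|) ,
      ≤-trans (≤-reflexive (double-suc k)) (≤-trans (+-monoʳ-≤ 2 degF) (degSum-add-neighbour Fu Fv Auv))
      where double-suc : ∀ k → 2 * suc k ≡ 2 + 2 * k
            double-suc = solve-∀

    connected⇒degSum≥ : ∀ {S x} → Connected A S → S x ≡ true → 2 * (size S ∸ 1) ≤ degSum S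
    connected⇒degSum≥ {S} conn Sx
      with connected⇒subset-of-size conn Sx (size S ∸ 1)
             (≤-reflexive (trans (+-comm 1 _) (m∸n+n≡m (size≥1 S Sx))))
    ... | F , F⊆S , _ , _ , degF = ≤-trans degF (degSum-⊆ F⊆S)

-- Trees

module _ {n} (T : Tree n) where

  private
    A : Adj n
    A = adj T

  ∁-connected⇒degSum≤ : ∀ {C x y} → C x ≡ true → C y ≡ false → Connected A (∁ C) →
    degSum A C ≤ 2 * (size C ∸ 1)
  ∁-connected⇒degSum≤ {C} {x} {y} Cx Cy ∁C-connected =
    bound (size≥1 C Cx) (size≥1 (∁ C) (cong not Cy)) total
          (connected⇒degSum≥ A (sym T) ∁C-connected (cong not Cy)) (crossing-edge A (conn T) Cx Cy)
    where
      total : degSum A C + degSum A (∁ C) + 2 * adjPairs A C (∁ C) ≡ 2 * (size C + size (∁ C) ∸ 1)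
      total = trans (degSum-∁ A (sym T) C) (trans (edges T) (cong (λ m → 2 * (m ∸ 1)) (≡-sym (size-∁ C))))
      bound : ∀ {e f p c d} → 1 ≤ c → 1 ≤ d → e + f + 2 * p ≡ 2 * (c + d ∸ 1) →
        2 * (d ∸ 1) ≤ f → 1 ≤ p → e ≤ 2 * (c ∸ 1)
      bound {e} {f} {p} {suc c} {suc d} _ _ total f≥ p≥ = +-cancelʳ-≤ (2 * d + 2) e (2 * c) (begin
        e + (2 * d + 2)        ≤⟨ +-monoʳ-≤ e (+-mono-≤ f≥ (*-monoʳ-≤ 2 p≥)) ⟩
        e + (f + 2 * p)        ≡⟨ +-assoc e f _ ⟨
        e + f + 2 * p          ≡⟨ total ⟩
        2 * (c + suc d)        ≡⟨ rearrange c d ⟩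
        2 * c + (2 * d + 2)    ∎)
        where
          open ≤-Reasoning
          rearrange : ∀ c d → 2 * (c + suc d) ≡ 2 * c + (2 * d + 2)
          rearrange = solve-∀

  component-∁-connected : ∀ {t C} → Component T t C → Connected A (∁ C)
  component-∁-connected {t} {C} (Ct , _ , _ , closed) i j ∁Ci ∁Cj =
    walk-++ (to-t (conn T i t refl refl) (not≡true ∁Ci))
            (walk-reverse (sym T) (to-t (conn T j t refl refl) (not≡true ∁Cj)))
    where
      to-t : ∀ {x} → Walk A all x t → C x ≡ false → Walk A (∁ C) x t
      to-t (here _) Cx = here (cong not Cx)
      to-t (step {x} {y} _ Axy p) Cx with x ≟ t | C y in Cy
      ... | yes refl | _     = here (cong not Cx)
      ... | no _     | false = step (cong not Cx) Axy (to-t p Cy)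
      ... | no x≢t   | true  with () ← trans (≡-sym (closed y x Cy (trans (sym T y x) Axy) x≢t)) Cx

  component-degSum : ∀ {t C} → Component T t C → degSum A C ≡ 2 * (size C ∸ 1)
  component-degSum component@(Ct , (x , Cx) , C-connected , _) =
    ≤-antisym (∁-connected⇒degSum≤ Cx Ct (component-∁-connected component))
              (connected⇒degSum≥ A (sym T) C-connected Cx)

  -- Saturating ⁅ i ⁆ under extend yields the vertices joined to i by a walk avoiding t.
  module Reach (t i : Fin n) where

    adjacentTo : Subset n → Fin n → Bool
    adjacentTo S j = does (FinP.any? (λ u → S u ∧ A u j B.≟ true))

    extend : Subset n → Subset n
    extend S = S ∪ (λ j → not ⌊ j ≟ t ⌋ ∧ adjacentTo S j)

    extend-≗ : ∀ {S S′} → S ≗ S′ → extend S ≗ extend S′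
    extend-≗ {S} {S′} S≗S′ j = cong₂ (λ a b → a ∨ (not ⌊ j ≟ t ⌋ ∧ b)) (S≗S′ j)
      (does-⇔ (mk⇔ (λ (u , h) → u , trans (cong (_∧ A u j) (≡-sym (S≗S′ u))) h)
                   (λ (u , h) → u , trans (cong (_∧ A u j) (S≗S′ u)) h))
              (FinP.any? (λ u → S u ∧ A u j B.≟ true))
              (FinP.any? (λ u → S′ u ∧ A u j B.≟ true)))

    extend-cases : ∀ S j → extend S j ≡ true →
      S j ≡ true ⊎ ∃ λ u → S u ≡ true × A u j ≡ true
    extend-cases S j extended with S j
    ... | true  = inj₁ refl
    ... | false with does-true⇒ (FinP.any? (λ u → S u ∧ A u j B.≟ true)) (proj₂ (∧-true extended))
    ...   | u , Su∧Auj = inj₂ (u , ∧-true Su∧Auj)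

    reached : ℕ → Subset n
    reached = fold ⁅ i ⁆ extend

    reached-suc : ∀ k → reached k ⊆ reached (suc k)
    reached-suc k = ⊆-∪ˡ {S = reached k}

    reached-t : i ≢ t → ∀ k → reached k t ≡ false
    reached-t i≢t zero = ≟-≢ (i≢t ∘ ≡-sym)
    reached-t i≢t (suc k) rewrite reached-t i≢t k | ≟-refl t = refl

    reached-i : ∀ k → reached k i ≡ true
    reached-i zero = ≟-refl i
    reached-i (suc k) = reached-suc k i (reached-i k)

    walk-from-i : ∀ k j → reached k j ≡ true → Walk A (reached k) i j
    walk-from-i zero j j≡i rewrite ⁅⁆-≡ j≡i = here (≟-refl i)
    walk-from-i (suc k) j Rj with extend-cases (reached k) j Rj
    ... | inj₁ Rkj = walk-⊆ (reached-suc k) (walk-from-i k j Rkj)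
    ... | inj₂ (u , Rku , Auj) =
      walk-++ (walk-⊆ (reached-suc k) (walk-from-i k u Rku)) (step (reached-suc k u Rku) Auj (here Rj))

    reached-closed : ∀ a b → reached n a ≡ true → A a b ≡ true → b ≢ t → reached n b ≡ true
    reached-closed a b Ra Aab b≢t =
      trans (≡-sym (fold-stable extend (λ S → ⊆-∪ˡ {S = S}) extend-≗ ⁅ i ⁆ b)) extended
      where
        extended : extend (reached n) b ≡ true
        extended rewrite ≟-≢ b≢t
                       | dec-true (FinP.any? (λ u → reached n u ∧ A u b B.≟ true)) (a , cong₂ _∧_ Ra Aab)
          = ∨-zeroʳ (reached n b)

  component-containing : ∀ {t i} → i ≢ t → ∃ λ C → Component T t C × C i ≡ true
  component-containing {t} {i} i≢t =
    reached n , (reached-t i≢t n , (i , reached-i n) , connected , reached-closed) , reached-i n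
    where
      open Reach t i
      connected : Connected A (reached n)
      connected a b Ra Rb = walk-++ (walk-reverse (sym T) (walk-from-i n a Ra)) (walk-from-i n b Rb)

-- Chip firing

module _ {n} {A : Adj n} {S : Subset n} where

  fires*-trans : ∀ {c d e} → Fires* A S c d → Fires* A S d e → Fires* A S c e
  fires*-trans done q = q
  fires*-trans (fireStep i Si legal p) q = fireStep i Si legal (fires*-trans p q)

  fires*⁺-trans : ∀ {c d e} → Fires* A S c d → Fires⁺ A S d e → Fires⁺ A S c e
  fires*⁺-trans done q = q
  fires*⁺-trans (fireStep i Si legal p) (fireStep j Sj legal′ q) =
    fireStep i Si legal (fires*-trans p (fireStep j Sj legal′ q))

fire-self : ∀ {n} (A : Adj n) S (d : Config n) v → fire A S d v v ≡ d v ∸ degIn A S v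
fire-self A S d v rewrite ≟-refl v = refl

fire-other : ∀ {n} (A : Adj n) S (d : Config n) {v j} → j ≢ v →
  fire A S d v j ≡ 𝟙 (S j ∧ A v j) + d j
fire-other A S d {v} {j} j≢v rewrite ≟-≢ j≢v with S j ∧ A v j
... | true  = refl
... | false = refl

module _ {n} (c : Config n) where

  minusE-self : ∀ v → minusE c v v ≡ c v ∸ 1
  minusE-self v rewrite ≟-refl v = refl

  minusE-other : ∀ {v j} → j ≢ v → minusE c v j ≡ c j
  minusE-other j≢v rewrite ≟-≢ j≢v = refl

  minusE-≤ : ∀ v j → minusE c v j ≤ c j
  minusE-≤ v j with toSum (j ≟ v)
  ... | inj₁ refl = subst (_≤ c j) (≡-sym (minusE-self j)) (m∸n≤m (c j) 1)
  ... | inj₂ j≢v  = ≤-reflexive (minusE-other j≢v)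

  <⇒≤-minusE-self : ∀ {x v} → x < c v → x ≤ minusE c v v
  <⇒≤-minusE-self {v = v} x<cv = subst (_ ≤_) (≡-sym (minusE-self v)) (<⇒≤∸1 x<cv)

  ≤-minusE-self⇒< : ∀ {x v} → 1 ≤ c v → x ≤ minusE c v v → x < c v
  ≤-minusE-self⇒< {v = v} 1≤cv x≤ = ≤∸1⇒< 1≤cv (subst (_ ≤_) (minusE-self v) x≤)

  minusE-≤-minusE : ∀ u {v j} → j ≢ v → minusE c u j ≤ minusE c v j
  minusE-≤-minusE u {j = j} j≢v = subst (minusE c u j ≤_) (≡-sym (minusE-other j≢v)) (minusE-≤ u j)

  chips-minusE : ∀ S {i} → S i ≡ true → 1 ≤ c i → suc (chips S (minusE c i)) ≡ chips S c
  chips-minusE S {i} Si 1≤ci = cancel (c i) 1≤ci (begin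
    chips S (minusE c i) + c i   ≡⟨ sumOver-update S Si (λ _ _ → minusE-other) ⟩
    chips S c + minusE c i i     ≡⟨ cong (chips S c +_) (minusE-self i) ⟩
    chips S c + (c i ∸ 1)        ∎)
    where
      open ≡-Reasoning
      cancel : ∀ m {x y} → 1 ≤ m → x + m ≡ y + (m ∸ 1) → suc x ≡ y
      cancel (suc m) {x} {y} _ eq = +-cancelʳ-≡ m (suc x) y (trans (≡-sym (+-suc x m)) eq)

-- Firing orders

InjectiveOn : ∀ {n} → Subset n → (Fin n → ℕ) → Set
InjectiveOn {n} S r = ∀ (v w : Fin n) → S v ≡ true → S w ≡ true → r v ≡ r w → v ≡ w

module _ {n} (A : Adj n) where

  outDeg : Subset n → (Fin n → ℕ) → Fin n → ℕ
  outDeg S r v = sumOver S (λ w → 𝟙 (A v w ∧ (r v <ᵇ r w)))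

  -- Firing every vertex of S once, in increasing rank, is legal exactly when every vertex
  -- holds at least as many chips as it has higher-ranked neighbours; it then returns to c.
  record FiringOrder (S : Subset n) (c : Config n) : Set where
    field
      rank      : Fin n → ℕ
      injective : InjectiveOn S rank
      enough    : ∀ v → S v ≡ true → outDeg S rank v ≤ c v

  outDeg≤degIn : ∀ S r v → outDeg S r v ≤ degIn A S v
  outDeg≤degIn S r v = subst (outDeg S r v ≤_) (≡-sym (degIn≡sumOver A S v))
    (sumOver-mono-≤ S (λ w _ → 𝟙-∧ˡ (A v w) _))

  FiringOrder-⊆ : ∀ {C S c} → C ⊆ S → FiringOrder S c → FiringOrder C c
  FiringOrder-⊆ C⊆S order = record
    { rank      = rank
    ; injective = λ v w Cv Cw → injective v w (C⊆S v Cv) (C⊆S w Cw)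
    ; enough    = λ v Cv → ≤-trans (sumOver-⊆ (λ w → 𝟙 (A v w ∧ (rank v <ᵇ rank w))) C⊆S)
                                   (enough v (C⊆S v Cv))
    }
    where open FiringOrder order

  FiringOrder-mono : ∀ {S c c′} → (∀ v → S v ≡ true → c v ≤ c′ v) →
    FiringOrder S c → FiringOrder S c′
  FiringOrder-mono c≤c′ order = record
    { rank = rank ; injective = injective ; enough = λ v Sv → ≤-trans (enough v Sv) (c≤c′ v Sv) }
    where open FiringOrder order

  module _ (loopless : ∀ i → A i i ≡ false) (symmetric : ∀ i j → A i j ≡ A j i) where

    adjacent⇒≢ : ∀ {u v} → A u v ≡ true → u ≢ v
    adjacent⇒≢ {u} Auv refl with () ← trans (≡-sym Auv) (loopless u)

    sumOver-outDeg : ∀ S r → InjectiveOn S r → 2 * sumOver S (outDeg S r) ≡ degSum A S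
    sumOver-outDeg S r injective = begin
      2 * sumOver S (outDeg S r)
        ≡⟨ double (sumOver S (outDeg S r)) ⟩
      sumOver S (outDeg S r) + sumOver S (outDeg S r)
        ≡⟨ cong (sumOver S (outDeg S r) +_) (sumOver-comm S S (λ a b → 𝟙 (A a b ∧ (r a <ᵇ r b)))) ⟩
      sumOver S (outDeg S r) + sumOver S (λ a → sumOver S (λ b → 𝟙 (A b a ∧ (r b <ᵇ r a))))
        ≡⟨ sumOver-+ S _ _ ⟨
      sumOver S (λ a → outDeg S r a + sumOver S (λ b → 𝟙 (A b a ∧ (r b <ᵇ r a))))
        ≡⟨ sumOver-cong S (λ a _ → sumOver-+ S _ _) ⟨
      sumOver S (λ a → sumOver S (λ b → 𝟙 (A a b ∧ (r a <ᵇ r b)) + 𝟙 (A b a ∧ (r b <ᵇ r a))))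
        ≡⟨ sumOver-cong S (λ a Sa → sumOver-cong S (λ b Sb → one-direction a b Sa Sb)) ⟩
      degSum A S
        ∎
      where
        open ≡-Reasoning
        double : ∀ x → 2 * x ≡ x + x
        double = solve-∀
        one-direction : ∀ a b → S a ≡ true → S b ≡ true →
          𝟙 (A a b ∧ (r a <ᵇ r b)) + 𝟙 (A b a ∧ (r b <ᵇ r a)) ≡ 𝟙 (A a b)
        one-direction a b Sa Sb rewrite symmetric b a with A a b in Aab
        ... | false = refl
        ... | true with r a <ᵇ r b | <ᵇ-reflects-< (r a) (r b) | r b <ᵇ r a | <ᵇ-reflects-< (r b) (r a)
        ...   | true  | ofʸ a<b | true  | ofʸ b<a = ⊥-elim (<-asym a<b b<a)
        ...   | true  | _       | false | _       = refl
        ...   | false | _       | true  | _       = refl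
        ...   | false | ofⁿ a≮b | false | ofⁿ b≮a =
          ⊥-elim (adjacent⇒≢ Aab (injective a b Sa Sb (≤-antisym (≮⇒≥ b≮a) (≮⇒≥ a≮b))))

    firingOrder⇒size∸1≤chips : ∀ {S x c} → Connected A S → S x ≡ true → FiringOrder S c →
      size S ∸ 1 ≤ chips S c
    firingOrder⇒size∸1≤chips {S} {x} {c} S-connected Sx order = *-cancelˡ-≤ 2 (begin
      2 * (size S ∸ 1)                ≤⟨ connected⇒degSum≥ A symmetric S-connected Sx ⟩
      degSum A S                      ≡⟨ sumOver-outDeg S rank injective ⟨
      2 * sumOver S (outDeg S rank)   ≤⟨ *-monoʳ-≤ 2 (sumOver-mono-≤ S enough) ⟩
      2 * chips S c                   ∎)
      where open ≤-Reasoning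
            open FiringOrder order

    module FireByRank {S : Subset n} {c : Config n} (order : FiringOrder S c) where

      open FiringOrder order renaming (rank to r)

      firedBefore : ℕ → Fin n → Bool
      firedBefore k w = r w <ᵇ k

      firedNeighbours : ℕ → Fin n → ℕ
      firedNeighbours k j = sumOver S (λ w → 𝟙 (A j w ∧ firedBefore k w))

      -- d is the configuration reached after firing, in rank order, the vertices of rank below k.
      Stage : ℕ → Config n → Set
      Stage k d = ∀ j → S j ≡ true →
        d j + (if firedBefore k j then degIn A S j else 0) ≡ c j + firedNeighbours k j

      firedBefore-suc : ∀ {w k} → r w ≢ k → firedBefore (suc k) w ≡ firedBefore k w
      firedBefore-suc rw≢k = <ᵇ-cong (λ w<k+1 → ≤∧≢⇒< (≤-pred w<k+1) rw≢k) m≤n⇒m≤1+n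

      firedNeighbours-skip : ∀ {k} → (∀ w → S w ≡ true → r w ≢ k) → ∀ j →
        firedNeighbours (suc k) j ≡ firedNeighbours k j
      firedNeighbours-skip none j =
        sumOver-cong S (λ w Sw → cong (λ b → 𝟙 (A j w ∧ b)) (firedBefore-suc (none w Sw)))

      firedNeighbours-fire : ∀ {k v} → S v ≡ true → r v ≡ k → ∀ j →
        firedNeighbours (suc k) j ≡ firedNeighbours k j + 𝟙 (A j v)
      firedNeighbours-fire {k} {v} Sv refl j = begin
        firedNeighbours (suc k) j
          ≡⟨ +-identityʳ _ ⟨
        firedNeighbours (suc k) j + 𝟙 false
          ≡⟨ cong (after ∘ 𝟙) (∧-zeroʳ (A j v)) ⟨
        firedNeighbours (suc k) j + 𝟙 (A j v ∧ false)
          ≡⟨ cong (after ∘ 𝟙 ∘ (A j v ∧_)) (<ᵇ-false (n≮n k)) ⟨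
        firedNeighbours (suc k) j + 𝟙 (A j v ∧ firedBefore k v)
          ≡⟨ sumOver-update S Sv unchanged ⟩
        firedNeighbours k j + 𝟙 (A j v ∧ firedBefore (suc k) v)
          ≡⟨ cong (before ∘ 𝟙 ∘ (A j v ∧_)) (<ᵇ-true (n<1+n k)) ⟩
        firedNeighbours k j + 𝟙 (A j v ∧ true)
          ≡⟨ cong (before ∘ 𝟙) (∧-identityʳ (A j v)) ⟩
        firedNeighbours k j + 𝟙 (A j v)
          ∎
        where
          open ≡-Reasoning
          before after : ℕ → ℕ
          before = firedNeighbours k j +_
          after  = firedNeighbours (suc k) j +_
          unchanged : ∀ w → S w ≡ true → w ≢ v →
            𝟙 (A j w ∧ firedBefore (suc k) w) ≡ 𝟙 (A j w ∧ firedBefore k w)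
          unchanged w Sw w≢v = cong (λ b → 𝟙 (A j w ∧ b)) (firedBefore-suc (w≢v ∘ injective w v Sw Sv))

      stage-unfired : ∀ {k d j} → Stage k d → S j ≡ true → ¬ r j < k → d j ≡ c j + firedNeighbours k j
      stage-unfired {k} {d} {j} stage Sj rj≮k = begin
        d j                                                  ≡⟨ +-identityʳ (d j) ⟨
        d j + 0                                              ≡⟨ cong (λ b → d j + (if b then degIn A S j else 0))
                                                                     (<ᵇ-false rj≮k) ⟨
        d j + (if firedBefore k j then degIn A S j else 0)   ≡⟨ stage j Sj ⟩
        c j + firedNeighbours k j                            ∎
        where open ≡-Reasoning

      stage-legal : ∀ {k d v} → S v ≡ true → r v ≡ k → Stage k d → degIn A S v ≤ d v
      stage-legal {d = d} {v} Sv refl stage = begin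
        degIn A S v                                 ≡⟨ degIn≡sumOver A S v ⟩
        sumOver S (λ w → 𝟙 (A v w))                 ≤⟨ sumOver-mono-≤ S split ⟩
        sumOver S (λ w → 𝟙 (A v w ∧ firedBefore (r v) w) + 𝟙 (A v w ∧ (r v <ᵇ r w)))
                                                    ≡⟨ sumOver-+ S _ _ ⟩
        firedNeighbours (r v) v + outDeg S r v      ≤⟨ +-monoʳ-≤ _ (enough v Sv) ⟩
        firedNeighbours (r v) v + c v               ≡⟨ +-comm _ (c v) ⟩
        c v + firedNeighbours (r v) v               ≡⟨ stage-unfired stage Sv (n≮n (r v)) ⟨
        d v                                         ∎
        where
          open ≤-Reasoning
          split : ∀ w → S w ≡ true →
            𝟙 (A v w) ≤ 𝟙 (A v w ∧ (r w <ᵇ r v)) + 𝟙 (A v w ∧ (r v <ᵇ r w))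
          split w Sw with A v w in Avw
          ... | false = z≤n
          ... | true with r w <ᵇ r v | <ᵇ-reflects-< (r w) (r v) | r v <ᵇ r w | <ᵇ-reflects-< (r v) (r w)
          ...   | true  | _       | _     | _       = s≤s z≤n
          ...   | false | _       | true  | _       = ≤-refl
          ...   | false | ofⁿ w≮v | false | ofⁿ v≮w =
            ⊥-elim (adjacent⇒≢ Avw (injective v w Sv Sw (≤-antisym (≮⇒≥ w≮v) (≮⇒≥ v≮w))))

      stage-fire : ∀ {k d v} → S v ≡ true → r v ≡ k → Stage k d → Stage (suc k) (fire A S d v)
      stage-fire {d = d} {v} Sv refl stage j Sj with toSum (j ≟ v)
      ... | inj₁ refl = begin
        fire A S d j j + (if firedBefore (suc (r j)) j then degIn A S j else 0)
          ≡⟨ cong₂ (λ x b → x + (if b then degIn A S j else 0)) (fire-self A S d j) (<ᵇ-true (n<1+n (r j))) ⟩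
        d j ∸ degIn A S j + degIn A S j
          ≡⟨ m∸n+n≡m (stage-legal Sj refl stage) ⟩
        d j
          ≡⟨ stage-unfired stage Sj (n≮n (r j)) ⟩
        c j + firedNeighbours (r j) j
          ≡⟨ cong (c j +_) (+-identityʳ _) ⟨
        c j + (firedNeighbours (r j) j + 𝟙 false)
          ≡⟨ cong (λ b → c j + (firedNeighbours (r j) j + 𝟙 b)) (loopless j) ⟨
        c j + (firedNeighbours (r j) j + 𝟙 (A j j))
          ≡⟨ cong (c j +_) (firedNeighbours-fire Sj refl j) ⟨
        c j + firedNeighbours (suc (r j)) j
          ∎
        where open ≡-Reasoning
      ... | inj₂ j≢v = begin
        fire A S d v j + (if firedBefore (suc (r v)) j then degIn A S j else 0)
          ≡⟨ cong₂ (λ x b → x + (if b then degIn A S j else 0))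
                   (fire-other A S d j≢v) (firedBefore-suc (j≢v ∘ injective j v Sj Sv)) ⟩
        𝟙 (S j ∧ A v j) + d j + (if firedBefore (r v) j then degIn A S j else 0)
          ≡⟨ +-assoc (𝟙 (S j ∧ A v j)) (d j) _ ⟩
        𝟙 (S j ∧ A v j) + (d j + (if firedBefore (r v) j then degIn A S j else 0))
          ≡⟨ cong₂ (λ b x → 𝟙 b + x) (trans (cong (_∧ A v j) Sj) (symmetric v j)) (stage j Sj) ⟩
        𝟙 (A j v) + (c j + firedNeighbours (r v) j)
          ≡⟨ rearrange (𝟙 (A j v)) (c j) _ ⟩
        c j + (firedNeighbours (r v) j + 𝟙 (A j v))
          ≡⟨ cong (c j +_) (firedNeighbours-fire Sv refl j) ⟨
        c j + firedNeighbours (suc (r v)) j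
          ∎
        where open ≡-Reasoning
              rearrange : ∀ a b c → a + (b + c) ≡ b + (c + a)
              rearrange = solve-∀

      stage-skip : ∀ {k d} → (∀ w → S w ≡ true → r w ≢ k) → Stage k d → Stage (suc k) d
      stage-skip none stage j Sj rewrite firedBefore-suc (none j Sj) | firedNeighbours-skip none j = stage j Sj

      stage-run : ∀ m {k d} → Stage k d → ∃ λ d′ → Fires* A S d d′ × Stage (k + m) d′
      stage-run zero {k} stage = _ , done , subst (λ i → Stage i _) (≡-sym (+-identityʳ k)) stage
      stage-run (suc m) {k} {d} stage with FinP.any? (λ v → (S v B.≟ true) ×-dec (r v ≟ℕ k))
      ... | yes (v , Sv , rv≡k) with stage-run m {suc k} (stage-fire Sv rv≡k stage)
      ...   | d′ , firings , stage′ =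
        d′ , fireStep v Sv (stage-legal Sv rv≡k stage) firings ,
        subst (λ i → Stage i d′) (≡-sym (+-suc k m)) stage′
      stage-run (suc m) {k} {d} stage | no none
        with stage-run m {suc k} (stage-skip (λ w Sw rw≡k → none (w , Sw , rw≡k)) stage)
      ...   | d′ , firings , stage′ = d′ , firings , subst (λ i → Stage i d′) (≡-sym (+-suc k m)) stage′

      stage-zero : Stage 0 c
      stage-zero j Sj = cong (c j +_) (≡-sym nothing-fired)
        where nothing-fired : firedNeighbours 0 j ≡ 0
              nothing-fired = trans (sumOver-cong S (λ w _ → cong 𝟙 (∧-zeroʳ (A j w)))) (sumOver-zero S)

      stage-final : ∀ {K d} → (∀ j → S j ≡ true → r j < K) → Stage K d →
        ∀ j → S j ≡ true → d j ≡ c j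
      stage-final {K} {d} below stage j Sj = +-cancelʳ-≡ (degIn A S j) (d j) (c j) (begin
        d j + degIn A S j                                    ≡⟨ cong (λ b → d j + (if b then degIn A S j else 0))
                                                                     (<ᵇ-true (below j Sj)) ⟨
        d j + (if firedBefore K j then degIn A S j else 0)   ≡⟨ stage j Sj ⟩
        c j + firedNeighbours K j                            ≡⟨ cong (c j +_) all-fired ⟩
        c j + degIn A S j                                    ∎)
        where
          open ≡-Reasoning
          fired : ∀ w → S w ≡ true → 𝟙 (A j w ∧ firedBefore K w) ≡ 𝟙 (A j w)
          fired w Sw = cong 𝟙 (trans (cong (A j w ∧_) (<ᵇ-true (below w Sw))) (∧-identityʳ _))
          all-fired : firedNeighbours K j ≡ degIn A S j
          all-fired = trans (sumOver-cong S fired) (≡-sym (degIn≡sumOver A S j))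

      selfReachable : ∀ {x} → S x ≡ true → SelfReachable A S c
      selfReachable {x} Sx with stage-run (r x) {0} stage-zero
      ... | d₁ , up-to-x , stage₁ with stage-run Σ[ r ] {suc (r x)} (stage-fire Sx refl stage₁)
      ...   | d₂ , after-x , stage₂ =
        d₂ , fires*⁺-trans up-to-x (fireStep x Sx (stage-legal Sx refl stage₁) after-x) ,
        stage-final below stage₂
        where below : ∀ j → S j ≡ true → r j < suc (r x + Σ[ r ])
              below j _ = s≤s (≤-trans (≤-Σ r j) (m≤n+m _ _))

    firingOrder⇒selfReachable : ∀ {S c x} → S x ≡ true → FiringOrder S c → SelfReachable A S c
    firingOrder⇒selfReachable Sx order = FireByRank.selfReachable order Sx

    module LastFiring (connected : Connected A all) (c : Config n) where

      -- L v is the time of the last firing of v so far (0 if v has not fired) and τ the current time.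
      record Tracked (d : Config n) (L : Fin n → ℕ) (τ : ℕ) : Set where
        field
          bounded  : ∀ v → L v ≤ τ
          distinct : ∀ v w → 0 < L v → L v ≡ L w → v ≡ w
          enough   : ∀ v → outDeg all L v ≤ d v
          unfired  : ∀ v → L v ≡ 0 → c v + outDeg all L v ≤ d v

      tracked-start : Tracked c (λ _ → 0) 0
      tracked-start = record
        { bounded  = λ _ → z≤n
        ; distinct = λ _ _ ()
        ; enough   = λ v → subst (_≤ c v) (≡-sym (nobody-later v)) z≤n
        ; unfired  = λ v _ → ≤-reflexive (trans (cong (c v +_) (nobody-later v)) (+-identityʳ (c v)))
        }
        where nobody-later : ∀ v → outDeg all (λ _ → 0) v ≡ 0
              nobody-later v = trans (sumOver-cong all (λ w _ → cong 𝟙 (∧-zeroʳ (A v w)))) (sumOver-zero {n} all)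

      outDeg-stamp : ∀ L v x {j} → j ≢ v → outDeg all (updateAt L v (λ _ → x)) j ≤ outDeg all L j + 𝟙 (A j v)
      outDeg-stamp L v x {j} j≢v = begin
        outDeg all L′ j                              ≤⟨ m≤m+n _ _ ⟩
        outDeg all L′ j + 𝟙 (A j v ∧ (L j <ᵇ L v))   ≡⟨ sumOver-update all refl unchanged ⟩
        outDeg all L j + 𝟙 (A j v ∧ (L′ j <ᵇ L′ v))  ≤⟨ +-monoʳ-≤ _ (𝟙-∧ˡ (A j v) _) ⟩
        outDeg all L j + 𝟙 (A j v)                   ∎
        where
          open ≤-Reasoning
          L′ : Fin n → ℕ
          L′ = updateAt L v (λ _ → x)
          unchanged : ∀ w → all w ≡ true → w ≢ v →
            𝟙 (A j w ∧ (L′ j <ᵇ L′ w)) ≡ 𝟙 (A j w ∧ (L j <ᵇ L w))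
          unchanged w _ w≢v =
            cong₂ (λ a b → 𝟙 (A j w ∧ (a <ᵇ b))) (updateAt-minimal j v L j≢v) (updateAt-minimal w v L w≢v)

      fire-gain : ∀ d v {j} → j ≢ v → d j + 𝟙 (A j v) ≡ fire A all d v j
      fire-gain d v {j} j≢v =
        trans (+-comm (d j) _) (trans (cong (λ b → 𝟙 b + d j) (symmetric j v)) (≡-sym (fire-other A all d j≢v)))

      module Stamp {d L τ} (tracked : Tracked d L τ) (v : Fin n) where

        open Tracked tracked

        L′ : Fin n → ℕ
        L′ = updateAt L v (λ _ → suc τ)

        L′-self : L′ v ≡ suc τ
        L′-self = updateAt-updates v L

        L′-other : ∀ {w} → w ≢ v → L′ w ≡ L w
        L′-other {w} w≢v = updateAt-minimal w v L w≢v

        stamp-≥ : ∀ w → L w ≤ L′ w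
        stamp-≥ w with toSum (w ≟ v)
        ... | inj₁ refl = subst (L w ≤_) (≡-sym L′-self) (m≤n⇒m≤1+n (bounded w))
        ... | inj₂ w≢v  = ≤-reflexive (≡-sym (L′-other w≢v))

        bounded′ : ∀ w → L′ w ≤ suc τ
        bounded′ w with toSum (w ≟ v)
        ... | inj₁ refl = ≤-reflexive L′-self
        ... | inj₂ w≢v  = subst (_≤ suc τ) (≡-sym (L′-other w≢v)) (m≤n⇒m≤1+n (bounded w))

        distinct′ : ∀ x y → 0 < L′ x → L′ x ≡ L′ y → x ≡ y
        distinct′ x y 0<L′x L′x≡L′y with toSum (x ≟ v) | toSum (y ≟ v)
        ... | inj₁ refl | inj₁ refl = refl
        ... | inj₁ refl | inj₂ y≢v  =
          ⊥-elim (1+n≰n (subst (_≤ τ) (trans (≡-sym (L′-other y≢v)) (trans (≡-sym L′x≡L′y) L′-self))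
                               (bounded y)))
        ... | inj₂ x≢v  | inj₁ refl =
          ⊥-elim (1+n≰n (subst (_≤ τ) (trans (≡-sym (L′-other x≢v)) (trans L′x≡L′y L′-self))
                               (bounded x)))
        ... | inj₂ x≢v  | inj₂ y≢v  =
          distinct x y (subst (0 <_) (L′-other x≢v) 0<L′x)
                       (trans (≡-sym (L′-other x≢v)) (trans L′x≡L′y (L′-other y≢v)))

        last-fired : outDeg all L′ v ≡ 0
        last-fired =
          trans (sumOver-cong all (λ w _ → cong 𝟙 (trans (cong (A v w ∧_) not-later) (∧-zeroʳ (A v w)))))
                (sumOver-zero {n} all)
          where not-later : ∀ {w} → (L′ v <ᵇ L′ w) ≡ false
                not-later {w} = <ᵇ-false (≤⇒≯ (subst (L′ w ≤_) (≡-sym L′-self) (bounded′ w)))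

        enough′ : ∀ j → outDeg all L′ j ≤ fire A all d v j
        enough′ j with toSum (j ≟ v)
        ... | inj₁ refl = subst (_≤ fire A all d v j) (≡-sym last-fired) z≤n
        ... | inj₂ j≢v  = begin
          outDeg all L′ j              ≤⟨ outDeg-stamp L v (suc τ) j≢v ⟩
          outDeg all L j + 𝟙 (A j v)   ≤⟨ +-monoˡ-≤ _ (enough j) ⟩
          d j + 𝟙 (A j v)              ≡⟨ fire-gain d v j≢v ⟩
          fire A all d v j             ∎
          where open ≤-Reasoning

        unfired′ : ∀ j → L′ j ≡ 0 → c j + outDeg all L′ j ≤ fire A all d v j
        unfired′ j L′j≡0 with toSum (j ≟ v)
        ... | inj₁ refl with () ← trans (≡-sym L′-self) L′j≡0
        ... | inj₂ j≢v = let Lj≡0 = trans (≡-sym (L′-other j≢v)) L′j≡0 in begin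
          c j + outDeg all L′ j                ≤⟨ +-monoʳ-≤ (c j) (outDeg-stamp L v (suc τ) j≢v) ⟩
          c j + (outDeg all L j + 𝟙 (A j v))   ≡⟨ +-assoc (c j) _ _ ⟨
          c j + outDeg all L j + 𝟙 (A j v)     ≤⟨ +-monoˡ-≤ _ (unfired j Lj≡0) ⟩
          d j + 𝟙 (A j v)                      ≡⟨ fire-gain d v j≢v ⟩
          fire A all d v j                     ∎
          where open ≤-Reasoning

        stamped : Tracked (fire A all d v) L′ (suc τ)
        stamped = record { bounded = bounded′ ; distinct = distinct′ ; enough = enough′ ; unfired = unfired′ }

      tracked-run : ∀ {d d′ L τ} → Tracked d L τ → Fires* A all d d′ →
        ∃ λ L′ → ∃ λ τ′ → Tracked d′ L′ τ′ × (∀ v → L v ≤ L′ v)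
      tracked-run {L = L} tracked done = L , _ , tracked , λ _ → ≤-refl
      tracked-run tracked (fireStep i _ _ firings) with tracked-run (Stamp.stamped tracked i) firings
      ... | L′ , τ′ , tracked′ , later =
        L′ , τ′ , tracked′ , λ v → ≤-trans (Stamp.stamp-≥ tracked i v) (later v)

      -- Every vertex fires: an unfired vertex next to a fired one would end with more chips than it began with.
      selfReachable⇒firingOrder : SelfReachable A all c → FiringOrder all c
      selfReachable⇒firingOrder (c′ , fireStep i _ _ firings , returns)
        with tracked-run (Stamp.stamped tracked-start i) firings
      ... | L , _ , tracked , later = record
        { rank      = L
        ; injective = λ v w _ _ → distinct v w (fired v)
        ; enough    = λ v _ → subst (outDeg all L v ≤_) (returns v refl) (enough v)
        }
        where
          open Tracked tracked
          fired-i : 0 < L i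
          fired-i = subst (_≤ L i) (updateAt-updates i (λ _ → 0)) (later i)
          spread : ∀ {u w} → 0 < L u → A u w ≡ true → 0 < L w
          spread {u} {w} 0<Lu Auw with L w in Lw
          ... | suc _ = s≤s z≤n
          ... | zero  = ⊥-elim (<-irrefl (≡-sym (returns w refl)) gains)
            where
              one-later : 1 ≤ outDeg all L w
              one-later = subst (_≤ outDeg all L w)
                (cong 𝟙 (cong₂ _∧_ (trans (symmetric w u) Auw) (<ᵇ-true (subst (_< L u) (≡-sym Lw) 0<Lu))))
                (≤-sumOver all (λ x → 𝟙 (A w x ∧ (L w <ᵇ L x))) {u} refl)
              gains : c w < c′ w
              gains = begin-strict
                c w                    <⟨ n<1+n (c w) ⟩
                suc (c w)              ≡⟨ +-comm 1 (c w) ⟩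
                c w + 1                ≤⟨ +-monoʳ-≤ (c w) one-later ⟩
                c w + outDeg all L w   ≤⟨ unfired w Lw ⟩
                c′ w                   ∎
                where open ≤-Reasoning
          fired : ∀ v → 0 < L v
          fired v = along (connected i v refl refl) fired-i
            where along : ∀ {x y} → Walk A all x y → 0 < L x → 0 < L y
                  along (here _) 0<Lx = 0<Lx
                  along (step _ Axy p) 0<Lx = along p (spread 0<Lx Axy)

-- Moving one vertex within a ranking

module _ {n} (r : Fin n → ℕ) (t : Fin n) (k : ℕ) where

  -- Doubling the ranks makes room to insert t just below all vertices of rank at least k.
  moveBelow : Fin n → ℕ
  moveBelow = updateAt (λ v → suc (2 * r v)) t (λ _ → 2 * k)

  moveBelow-self : moveBelow t ≡ 2 * k
  moveBelow-self = updateAt-updates t (λ v → suc (2 * r v))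

  moveBelow-other : ∀ {v} → v ≢ t → moveBelow v ≡ suc (2 * r v)
  moveBelow-other {v} v≢t = updateAt-minimal v t (λ v → suc (2 * r v)) v≢t

  moveBelow-<ᵇ : ∀ {v w} → v ≢ t → w ≢ t → (moveBelow v <ᵇ moveBelow w) ≡ (r v <ᵇ r w)
  moveBelow-<ᵇ {v} {w} v≢t w≢t rewrite moveBelow-other v≢t | moveBelow-other w≢t =
    <ᵇ-cong (λ lt → *-cancelˡ-< 2 (r v) (r w) (≤-pred lt)) (λ lt → s≤s (*-monoʳ-< 2 lt))

  moveBelow-<ᵇ-self : ∀ {v} → v ≢ t → (moveBelow v <ᵇ moveBelow t) ≡ (r v <ᵇ k)
  moveBelow-<ᵇ-self {v} v≢t rewrite moveBelow-other v≢t | moveBelow-self =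
    <ᵇ-cong (λ lt → *-cancelˡ-< 2 (r v) k (<-trans (n<1+n _) lt))
            (λ lt → ≤-trans (≤-reflexive (double-suc (r v))) (*-monoʳ-≤ 2 lt))
    where double-suc : ∀ x → suc (suc (2 * x)) ≡ 2 * suc x
          double-suc = solve-∀

  moveBelow-self-< : ∀ {w} → w ≢ t → moveBelow t < moveBelow w → k ≤ r w
  moveBelow-self-< {w} w≢t lt rewrite moveBelow-self | moveBelow-other w≢t = *-cancelˡ-≤ 2 (≤-pred lt)

  moveBelow-injective : ∀ {S} → InjectiveOn S r → InjectiveOn S moveBelow
  moveBelow-injective injective v w Sv Sw eq with toSum (v ≟ t) | toSum (w ≟ t)
  ... | inj₁ v≡t  | inj₁ w≡t  = trans v≡t (≡-sym w≡t)
  ... | inj₁ refl | inj₂ w≢t  =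
    ⊥-elim (even≢odd k (r w) (trans (≡-sym moveBelow-self) (trans eq (moveBelow-other w≢t))))
  ... | inj₂ v≢t  | inj₁ refl =
    ⊥-elim (even≢odd k (r v) (trans (≡-sym moveBelow-self) (trans (≡-sym eq) (moveBelow-other v≢t))))
  ... | inj₂ v≢t  | inj₂ w≢t  = injective v w Sv Sw (*-cancelˡ-≡ (r v) (r w) 2
    (suc-injective (trans (≡-sym (moveBelow-other v≢t)) (trans eq (moveBelow-other w≢t)))))

module _ {n} (A : Adj n) (r : Fin n → ℕ) (t : Fin n) (k : ℕ) where

  outDeg-moveBelow : ∀ {j} → j ≢ t →
    outDeg A all (moveBelow r t k) j + 𝟙 (A j t ∧ (r j <ᵇ r t)) ≡ outDeg A all r j + 𝟙 (A j t ∧ (r j <ᵇ k))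
  outDeg-moveBelow {j} j≢t =
    trans (sumOver-update all refl unchanged)
          (cong (λ b → outDeg A all r j + 𝟙 (A j t ∧ b)) (moveBelow-<ᵇ-self r t k j≢t))
    where unchanged : ∀ w → all w ≡ true → w ≢ t →
            𝟙 (A j w ∧ (moveBelow r t k j <ᵇ moveBelow r t k w)) ≡ 𝟙 (A j w ∧ (r j <ᵇ r w))
          unchanged w _ w≢t = cong (λ b → 𝟙 (A j w ∧ b)) (moveBelow-<ᵇ r t k j≢t w≢t)

  outDeg-moveBelow-≤ : k ≤ r t → ∀ {j} → j ≢ t → outDeg A all (moveBelow r t k) j ≤ outDeg A all r j
  outDeg-moveBelow-≤ k≤rt {j} j≢t = +-cancelʳ-≤ _ _ _ (begin
    outDeg A all (moveBelow r t k) j + 𝟙 (A j t ∧ (r j <ᵇ r t))  ≡⟨ outDeg-moveBelow j≢t ⟩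
    outDeg A all r j + 𝟙 (A j t ∧ (r j <ᵇ k))                    ≤⟨ +-monoʳ-≤ _ (𝟙-∧-mono (A j t) below-t) ⟩
    outDeg A all r j + 𝟙 (A j t ∧ (r j <ᵇ r t))                  ∎)
    where open ≤-Reasoning
          below-t : (r j <ᵇ k) ≡ true → (r j <ᵇ r t) ≡ true
          below-t rj<ᵇk = <ᵇ-true (<-≤-trans (<ᵇ-true⁻¹ rj<ᵇk) k≤rt)

-- Near-minimal configurations

module NearMinimal {n} (T : Tree n) (ν : Config n) (t : Fin n) where

  private
    A : Adj n
    A = adj T
    loopless : ∀ i → A i i ≡ false
    loopless = irrefl T
    symmetric : ∀ i j → A i j ≡ A j i
    symmetric = sym T

  firingOrder-of : ∀ {c} → SelfReachable A all c → FiringOrder A all c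
  firingOrder-of {c} = LastFiring.selfReachable⇒firingOrder A loopless symmetric (conn T) c

  firingOrder⇒MinusSR : ∀ {v} → 1 ≤ ν v → FiringOrder A all (minusE ν v) → MinusSR T ν v
  firingOrder⇒MinusSR {v} 1≤νv order = 1≤νv , firingOrder⇒selfReachable A loopless symmetric {x = v} refl order

  no-firingOrder-below-minimal : ∀ {S i} → Connected A S → S i ≡ true → 1 ≤ ν i →
    chips S ν ≡ size S ∸ 1 → ¬ FiringOrder A S (minusE ν i)
  no-firingOrder-below-minimal {S} {i} S-connected Si 1≤νi minimal order = 1+n≰n (begin
    suc (chips S (minusE ν i))   ≡⟨ chips-minusE ν S Si 1≤νi ⟩
    chips S ν                    ≡⟨ minimal ⟩
    size S ∸ 1                   ≤⟨ firingOrder⇒size∸1≤chips A loopless symmetric S-connected Si order ⟩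
    chips S (minusE ν i)         ∎)
    where open ≤-Reasoning

  module Forward (1≤νt : 1 ≤ ν t) (order : FiringOrder A all (minusE ν t))
                 (unique : ∀ i → MinusSR T ν i → i ≡ t) where

    open FiringOrder order renaming (rank to r)

    tight : ∀ {v} → v ≢ t → ν v ≤ outDeg A all r v
    tight {v} v≢t with ν v ≤? outDeg A all r v
    ... | yes ν≤outDeg = ν≤outDeg
    ... | no  ν≰outDeg = ⊥-elim (v≢t (unique v (firingOrder⇒MinusSR 1≤νv same-rank)))
      where
        outDeg<ν : outDeg A all r v < ν v
        outDeg<ν = ≰⇒> ν≰outDeg
        1≤νv : 1 ≤ ν v
        1≤νv = ≤-trans (s≤s z≤n) outDeg<ν
        enough′ : ∀ j → all j ≡ true → outDeg A all r j ≤ minusE ν v j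
        enough′ j _ with toSum (j ≟ v)
        ... | inj₁ refl = <⇒≤-minusE-self ν outDeg<ν
        ... | inj₂ j≢v  = ≤-trans (enough j refl) (minusE-≤-minusE ν t j≢v)
        same-rank : FiringOrder A all (minusE ν v)
        same-rank = record { rank = r ; injective = injective ; enough = enough′ }

    -- If some neighbour of t were ranked below t, moving t just below the highest such neighbour m
    -- would free a chip at m.
    module MoveTBelow {m} (Atm : A t m ≡ true) (m<t : r m < r t)
                      (m-max : ∀ w → A t w ≡ true → r w < r t → r w ≤ r m) where

      r′ : Fin n → ℕ
      r′ = moveBelow r t (r m)

      m≢t : m ≢ t
      m≢t m≡t = adjacent⇒≢ A loopless symmetric Atm (≡-sym m≡t)

      m-loses : suc (outDeg A all r′ m) ≤ ν m
      m-loses = begin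
        suc (outDeg A all r′ m)                        ≡⟨ +-comm 1 _ ⟩
        outDeg A all r′ m + 1                          ≡⟨ cong (outDeg A all r′ m +_) edge-term ⟨
        outDeg A all r′ m + 𝟙 (A m t ∧ (r m <ᵇ r t))   ≡⟨ outDeg-moveBelow A r t (r m) m≢t ⟩
        outDeg A all r m + 𝟙 (A m t ∧ (r m <ᵇ r m))    ≡⟨ cong (outDeg A all r m +_) self-term ⟩
        outDeg A all r m + 0                           ≡⟨ +-identityʳ _ ⟩
        outDeg A all r m                               ≤⟨ enough m refl ⟩
        minusE ν t m                                   ≡⟨ minusE-other ν m≢t ⟩
        ν m                                            ∎
        where
          open ≤-Reasoning
          edge-term : 𝟙 (A m t ∧ (r m <ᵇ r t)) ≡ 1
          edge-term = cong 𝟙 (cong₂ _∧_ (trans (symmetric m t) Atm) (<ᵇ-true m<t))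
          self-term : 𝟙 (A m t ∧ (r m <ᵇ r m)) ≡ 0
          self-term = cong 𝟙 (trans (cong (A m t ∧_) (<ᵇ-false (n≮n (r m)))) (∧-zeroʳ (A m t)))

      t-gains-only-m : ∀ w →
        𝟙 (A t w ∧ (r′ t <ᵇ r′ w)) ≤ 𝟙 (A t w ∧ (r t <ᵇ r w)) + 𝟙 (⁅ m ⁆ w)
      t-gains-only-m w with A t w in Atw
      ... | false = z≤n
      ... | true with toSum (w ≟ m) | r′ t <ᵇ r′ w | <ᵇ-reflects-< (r′ t) (r′ w)
      ...   | inj₁ refl | _     | _       rewrite ≟-refl w = ≤-trans (𝟙-∧ˡ true _) (m≤n+m 1 _)
      ...   | inj₂ _    | false | _       = z≤n
      ...   | inj₂ w≢m  | true  | ofʸ t<w =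
        subst (λ b → 1 ≤ 𝟙 b + 𝟙 (⁅ m ⁆ w)) (≡-sym (<ᵇ-true rt<rw)) (s≤s z≤n)
        where
          w≢t : w ≢ t
          w≢t w≡t = adjacent⇒≢ A loopless symmetric Atw (≡-sym w≡t)
          rm<rw : r m < r w
          rm<rw = ≤∧≢⇒< (moveBelow-self-< r t (r m) w≢t t<w)
                        (λ eq → w≢m (injective w m refl refl (≡-sym eq)))
          rt<rw : r t < r w
          rt<rw = ≤∧≢⇒< (≮⇒≥ (λ rw<rt → <⇒≱ rm<rw (m-max w Atw rw<rt)))
                        (λ eq → w≢t (injective w t refl refl (≡-sym eq)))

      t-bound : outDeg A all r′ t ≤ ν t
      t-bound = begin
        outDeg A all r′ t
          ≤⟨ sumOver-mono-≤ all (λ w _ → t-gains-only-m w) ⟩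
        sumOver all (λ w → 𝟙 (A t w ∧ (r t <ᵇ r w)) + 𝟙 (⁅ m ⁆ w))
          ≡⟨ sumOver-+ all (λ w → 𝟙 (A t w ∧ (r t <ᵇ r w))) (λ w → 𝟙 (⁅ m ⁆ w)) ⟩
        outDeg A all r t + size ⁅ m ⁆
          ≡⟨ trans (cong (outDeg A all r t +_) (size-⁅⁆ m)) (+-comm _ 1) ⟩
        suc (outDeg A all r t)
          ≤⟨ ≤-minusE-self⇒< ν 1≤νt (enough t refl) ⟩
        ν t
          ∎
        where open ≤-Reasoning

      enough′ : ∀ j → all j ≡ true → outDeg A all r′ j ≤ minusE ν m j
      enough′ j _ with toSum (j ≟ t) | toSum (j ≟ m)
      ... | inj₁ refl | _         =
        subst (outDeg A all r′ j ≤_) (≡-sym (minusE-other ν (m≢t ∘ ≡-sym))) t-bound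
      ... | inj₂ _    | inj₁ refl = <⇒≤-minusE-self ν m-loses
      ... | inj₂ j≢t  | inj₂ j≢m  =
        ≤-trans (outDeg-moveBelow-≤ A r t (r m) (<⇒≤ m<t) j≢t)
                (≤-trans (enough j refl) (minusE-≤-minusE ν t j≢m))

      m-freed : MinusSR T ν m
      m-freed = firingOrder⇒MinusSR (≤-trans (s≤s z≤n) m-loses)
        (record { rank = r′ ; injective = moveBelow-injective r t (r m) injective ; enough = enough′ })

    neighbours-above : ∀ {u} → A t u ≡ true → r t < r u
    neighbours-above {u} Atu with r t <? r u
    ... | yes t<u = t<u
    ... | no  t≮u with maximum (λ w → (A t w B.≟ true) ×-dec (r w <? r t)) r (u , Atu , u<t)
      where u<t : r u < r t
            u<t = ≤∧≢⇒< (≮⇒≥ t≮u)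
                        (λ eq → adjacent⇒≢ A loopless symmetric Atu (injective t u refl refl (≡-sym eq)))
    ... | m , (Atm , m<t) , m-max = ⊥-elim (adjacent⇒≢ A loopless symmetric Atm (≡-sym (unique m m-freed)))
      where open MoveTBelow Atm m<t (λ w Atw w<t → m-max w (Atw , w<t))

    deg<ν : suc (deg A t) ≤ ν t
    deg<ν = ≤-minusE-self⇒< ν 1≤νt (begin
      deg A t                         ≡⟨ degIn≡sumOver A all t ⟩
      sumOver all (λ w → 𝟙 (A t w))   ≡⟨ sumOver-cong all (λ w _ → all-above w) ⟨
      outDeg A all r t                ≤⟨ enough t refl ⟩
      minusE ν t t                    ∎)
      where
        open ≤-Reasoning
        all-above : ∀ w → 𝟙 (A t w ∧ (r t <ᵇ r w)) ≡ 𝟙 (A t w)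
        all-above w with A t w in Atw
        ... | true  = cong 𝟙 (<ᵇ-true (neighbours-above Atw))
        ... | false = refl

    component-minimal : ∀ {C} → Component T t C → MinSelfReachable A C ν
    component-minimal {C} component@(Ct , (x , Cx) , _ , closed) = self-reachable , chips≡size∸1
      where
        ≢t : ∀ {v} → C v ≡ true → v ≢ t
        ≢t Cv refl with () ← trans (≡-sym Cv) Ct

        leaving-C : ∀ {v} w → C v ≡ true → C w ≡ false → 𝟙 (A v w ∧ (r v <ᵇ r w)) ≡ 0
        leaving-C {v} w Cv Cw with A v w in Avw | toSum (w ≟ t)
        ... | false | _         = refl
        ... | true  | inj₁ refl = cong 𝟙 (<ᵇ-false (<⇒≯ (neighbours-above (trans (symmetric w v) Avw))))
        ... | true  | inj₂ w≢t  with () ← trans (≡-sym (closed v w Cv Avw w≢t)) Cw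

        outDeg-C : ∀ {v} → C v ≡ true → outDeg A C r v ≡ outDeg A all r v
        outDeg-C {v} Cv =
          sumOver-⊆-≡ (λ w → 𝟙 (A v w ∧ (r v <ᵇ r w))) (λ _ _ → refl) (λ w _ Cw → leaving-C w Cv Cw)

        ν≡outDeg : ∀ v → C v ≡ true → ν v ≡ outDeg A C r v
        ν≡outDeg v Cv = trans (≤-antisym (tight (≢t Cv)) (≤-trans (enough v refl) (minusE-≤ ν t v)))
                              (≡-sym (outDeg-C Cv))

        chips≡size∸1 : chips C ν ≡ size C ∸ 1
        chips≡size∸1 = *-cancelˡ-≡ _ _ 2 (begin
          2 * chips C ν                  ≡⟨ cong (2 *_) (sumOver-cong C ν≡outDeg) ⟩
          2 * sumOver C (outDeg A C r)   ≡⟨ sumOver-outDeg A loopless symmetric C r injective-C ⟩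
          degSum A C                     ≡⟨ component-degSum T component ⟩
          2 * (size C ∸ 1)               ∎)
          where open ≡-Reasoning
                injective-C : InjectiveOn C r
                injective-C v w _ _ = injective v w refl refl

        self-reachable : SelfReachable A C ν
        self-reachable = firingOrder⇒selfReachable A loopless symmetric Cx
          (FiringOrder-mono A (λ v _ → minusE-≤ ν t v) (FiringOrder-⊆ A (λ _ _ → refl) order))

  forward : NearMinSRAbout T ν t →
    (∀ C → Component T t C → MinSelfReachable A C ν) × suc (deg A t) ≤ ν t
  forward (_ , _ , (1≤νt , sr-t) , unique) = (λ _ → component-minimal) , deg<ν
    where open Forward 1≤νt (firingOrder-of sr-t) unique

  backward : SelfReachable A all ν → (∀ C → Component T t C → MinSelfReachable A C ν) →
    suc (deg A t) ≤ ν t → NearMinSRAbout T ν t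
  backward sr components-minimal deg<νt = sr , not-minimal , firingOrder⇒MinusSR 1≤νt t-first , unique
    where
      open FiringOrder (firingOrder-of sr) renaming (rank to r)

      1≤νt : 1 ≤ ν t
      1≤νt = ≤-trans (s≤s z≤n) deg<νt

      enough′ : ∀ j → all j ≡ true → outDeg A all (moveBelow r t 0) j ≤ minusE ν t j
      enough′ j _ with toSum (j ≟ t)
      ... | inj₁ refl = ≤-trans (outDeg≤degIn A all (moveBelow r t 0) j) (<⇒≤-minusE-self ν deg<νt)
      ... | inj₂ j≢t  = ≤-trans (outDeg-moveBelow-≤ A r t 0 z≤n j≢t)
                                (subst (outDeg A all r j ≤_) (≡-sym (minusE-other ν j≢t)) (enough j refl))

      t-first : FiringOrder A all (minusE ν t)
      t-first = record { rank = moveBelow r t 0 ; injective = moveBelow-injective r t 0 injective ; enough = enough′ }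

      not-minimal : ¬ MinSelfReachable A all ν
      not-minimal (_ , minimal) = no-firingOrder-below-minimal (conn T) refl 1≤νt minimal t-first

      unique : ∀ i → MinusSR T ν i → i ≡ t
      unique i (1≤νi , sr-i) with toSum (i ≟ t)
      ... | inj₁ i≡t = i≡t
      ... | inj₂ i≢t with component-containing T i≢t
      ...   | C , component@(_ , _ , C-connected , _) , Ci =
        ⊥-elim (no-firingOrder-below-minimal C-connected Ci 1≤νi (proj₂ (components-minimal C component))
                  (FiringOrder-⊆ A (λ _ _ → refl) (firingOrder-of sr-i)))

lemma5p4 : (n : ℕ) → 1 ≤ n → (T : Tree n) → (ν : Config n) →
    SelfReachable (adj T) all ν → (t : Fin n) →
    NearMinSRAbout T ν t ⇔
      ((∀ (C : Subset n) → Component T t C → MinSelfReachable (adj T) C ν) ×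
       suc (deg (adj T) t) ≤ ν t)
lemma5p4 n _ T ν sr t =
  mk⇔ forward (λ (components-minimal , deg<νt) → backward sr components-minimal deg<νt)
  where open NearMinimal T ν t
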